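{- Define integers $d_2 = 4$ and $d_j = j^{d_{j-1}/(j-1)}$ for $j \ge 3$, and for $k \ge 2$ let $\alpha_k = \prod_{j=2}^k (1 - 1/d_j)$. Then the infinite product $\alpha = \prod_{j=2}^\infty (1 - 1/d_j)$ converges, and for every $k \ge 2$, $$\alpha_k > \alpha > \alpha_k - \frac{2}{d_{k+1}}.$$ -}

module Defs where

open import Data.Nat as ℕ using (ℕ; zero; suc; _^_; NonZero)
open import Data.Nat.Properties using (m^n≢0)
open import Data.Integer using (+_)
open import Data.Rational using (ℚ; 0ℚ; 1ℚ; _/_; _+_; _-_; _*_; _<_; _≤_; ∣_∣)
open import Data.Product using (Σ; ∃; _×_)

-- d j for j ≥ 2 as in the paper: d 2 = 4, d j = j ^ (d (j-1) / (j-1)) for j ≥ 3.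
-- d 0 and d 1 are unused junk values (set to 1).
d : ℕ → ℕ
d zero = 1
d (suc zero) = 1
d (suc (suc zero)) = 4
d (suc (suc (suc j))) = suc (suc (suc j)) ^ (d (suc (suc j)) ℕ./ suc (suc j))

d-nonZero : ∀ j → NonZero (d j)
d-nonZero zero = _
d-nonZero (suc zero) = _
d-nonZero (suc (suc zero)) = _
d-nonZero (suc (suc (suc j))) = m^n≢0 (suc (suc (suc j))) (d (suc (suc j)) ℕ./ suc (suc j))

inv-d : ℕ → ℚ
inv-d j = (+ 1) / d j
  where instance _ = d-nonZero j

α : ℕ → ℚ
α zero = 1ℚ
α (suc zero) = 1ℚ
α (suc (suc k)) = α (suc k) * (1ℚ - inv-d (2 ℕ.+ k))

-- Convergence of a rational sequence (Cauchy criterion; its limit is a real number).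
Converges : (ℕ → ℚ) → Set
Converges s = ∀ ε → 0ℚ < ε → ∃ λ N → ∀ m n → N ℕ.≤ m → N ℕ.≤ n → ∣ s m - s n ∣ < ε

-- For a convergent sequence s: (lim s) < q, written out.
LimBelow : (ℕ → ℚ) → ℚ → Set
LimBelow s q = Σ ℚ λ ε → 0ℚ < ε × (∃ λ N → ∀ m → N ℕ.≤ m → s m + ε ≤ q)

-- For a convergent sequence s: q < (lim s), written out.
LimAbove : ℚ → (ℕ → ℚ) → Set
LimAbove q s = Σ ℚ λ ε → 0ℚ < ε × (∃ λ N → ∀ m → N ℕ.≤ m → q + ε ≤ s m)

{-# OPTIONS --safe #-}
-- Write a_j = 1/d_j. For j ≥ 3 the exponent x = ⌊d_j/j⌋ is at least 3, and d_j < j(x+1), so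
-- d_{j+1} = (j+1)^x ≥ 4(j+1)(x+1) > 4 d_j; by induction also d_j ≥ 3j. Hence α_n is positive and
-- decreasing with α_n − α_{n+1} = α_n a_{n+1} ≤ a_{n+1}, and as the a_j shrink at least by the
-- factor 1/4 from j = 3 on, α_k − α_n ≤ a_{k+1}(1 + 1/4 + 1/16 + ⋯) = (4/3) a_{k+1} for n ≥ k ≥ 2.
-- This makes α Cauchy and traps its limit between α_k − (4/3) a_{k+1} > α_k − 2 a_{k+1} and
-- α_{k+1} = α_k − α_k a_{k+1} < α_k.
module Submission where

open import Defs

module _ where
  open import Data.Nat
  open import Data.Nat.Properties
  open import Data.Nat.DivMod using (_/_; _%_; m≡m%n+[m/n]*n; m%n≤n; m*n/n≡m; /-monoˡ-≤)
  open import Data.Nat.Tactic.RingSolver using (solve)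
  open import Data.List.Base using (_∷_; [])
  open import Relation.Binary.PropositionalEquality using (cong; subst)
  open ≤-Reasoning

  m≤[1+m/n]*n : ∀ m n .{{_ : NonZero n}} → m ≤ suc (m / n) * n
  m≤[1+m/n]*n m n = begin
    m                  ≡⟨ m≡m%n+[m/n]*n m n ⟩
    m % n + m / n * n  ≤⟨ +-monoˡ-≤ (m / n * n) (m%n≤n m n) ⟩
    suc (m / n) * n    ∎

  4*b*[1+x]≤b^x : ∀ {b x} → 4 ≤ b → 3 ≤ x → 4 * b * suc x ≤ b ^ x
  4*b*[1+x]≤b^x {b} 4≤b 3≤x = go (≤⇒≤′ 3≤x)
    where
    go : ∀ {x} → 3 ≤′ x → 4 * b * suc x ≤ b ^ x
    go ≤′-refl = begin
      4 * b * 4    ≡⟨ solve (b ∷ []) ⟩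
      4 * 4 * b    ≤⟨ *-monoˡ-≤ b (*-mono-≤ 4≤b 4≤b) ⟩
      b * b * b    ≡⟨ solve (b ∷ []) ⟩
      b * (b * (b * 1)) ∎
    go (≤′-step {x} 3≤′x) = begin
      4 * b * suc (suc x)    ≤⟨ *-monoʳ-≤ (4 * b) (s≤s (m≤n+m (suc x) x)) ⟩
      4 * b * (suc x + suc x) ≡⟨ solve (b ∷ x ∷ []) ⟩
      2 * (4 * b * suc x)    ≤⟨ *-monoʳ-≤ 2 (go 3≤′x) ⟩
      2 * b ^ x              ≤⟨ *-monoˡ-≤ (b ^ x) (≤-trans (s≤s (s≤s z≤n)) 4≤b) ⟩
      b * b ^ x              ∎

  3*[3+k]≤d[3+k]⇒4*d[3+k]≤d[4+k] : ∀ k → 3 * (3 + k) ≤ d (3 + k) → 4 * d (3 + k) ≤ d (4 + k)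
  3*[3+k]≤d[3+k]⇒4*d[3+k]≤d[4+k] k 3j≤dj = begin
    4 * d j              ≤⟨ *-monoʳ-≤ 4 (m≤[1+m/n]*n (d j) j) ⟩
    4 * (suc x * j)      ≤⟨ *-monoʳ-≤ 4 (*-monoʳ-≤ (suc x) (n≤1+n j)) ⟩
    4 * (suc x * suc j)  ≡⟨ cong (4 *_) (*-comm (suc x) (suc j)) ⟩
    4 * (suc j * suc x)  ≡⟨ *-assoc 4 (suc j) (suc x) ⟨
    4 * suc j * suc x    ≤⟨ 4*b*[1+x]≤b^x (s≤s (s≤s (s≤s (s≤s z≤n)))) 3≤x ⟩
    suc j ^ x            ∎
    where
    j = 3 + k
    x = d j / j
    3≤x : 3 ≤ x
    3≤x = subst (_≤ x) (m*n/n≡m 3 j) (/-monoˡ-≤ j 3j≤dj)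

  3*[3+k]≤d[3+k] : ∀ k → 3 * (3 + k) ≤ d (3 + k)
  3*[3+k]≤d[3+k] zero = ≤-refl
  3*[3+k]≤d[3+k] (suc k) = begin
    3 * (4 + k)                   ≤⟨ m≤m+n (3 * (4 + k)) (24 + 9 * k) ⟩
    3 * (4 + k) + (24 + 9 * k)    ≡⟨ solve (k ∷ []) ⟩
    4 * (3 * (3 + k))             ≤⟨ *-monoʳ-≤ 4 (3*[3+k]≤d[3+k] k) ⟩
    4 * d (3 + k)                 ≤⟨ 3*[3+k]≤d[3+k]⇒4*d[3+k]≤d[4+k] k (3*[3+k]≤d[3+k] k) ⟩
    d (4 + k)                     ∎

  4*d[3+k]≤d[4+k] : ∀ k → 4 * d (3 + k) ≤ d (4 + k)
  4*d[3+k]≤d[4+k] k = 3*[3+k]≤d[3+k]⇒4*d[3+k]≤d[4+k] k (3*[3+k]≤d[3+k] k)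

  1<d[2+k] : ∀ k → 1 < d (2 + k)
  1<d[2+k] zero = s≤s (s≤s z≤n)
  1<d[2+k] (suc k) = ≤-trans (s≤s (s≤s z≤n)) (3*[3+k]≤d[3+k] k)

  4*[1+k]<3*d[3+k] : ∀ k → 4 * suc k < 3 * d (3 + k)
  4*[1+k]<3*d[3+k] k = begin-strict
    4 * suc k                    <⟨ m<m+n (4 * suc k) (s≤s z≤n) ⟩
    4 * suc k + (23 + 5 * k)     ≡⟨ solve (k ∷ []) ⟩
    3 * (3 * (3 + k))            ≤⟨ *-monoʳ-≤ 3 (3*[3+k]≤d[3+k] k) ⟩
    3 * d (3 + k)                ∎

module _ where
  open import Data.Nat as ℕ using (ℕ; zero; suc; z≤n; s≤s; _≤′_; ≤′-refl; ≤′-step)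
  import Data.Nat.Properties as ℕ
  open import Data.Integer as ℤ using (+_)
  import Data.Integer.Properties as ℤ
  open import Data.Rational
  open import Data.Rational.Properties
  open import Data.Rational.Unnormalised as ℚᵘ using (mkℚᵘ)
  import Data.Rational.Unnormalised.Properties as ℚᵘ
  open import Data.Product using (∃-syntax; _×_; _,_)
  open import Data.Sum using (inj₁; inj₂)
  open import Relation.Binary.PropositionalEquality using (_≡_; cong; sym; trans; subst; subst₂)
  open import Relation.Nullary.Decidable using (dec⇒maybe)
  open import Tactic.RingSolver using (solve-∀)
  open import Tactic.RingSolver.Core.AlmostCommutativeRing using (AlmostCommutativeRing; fromCommutativeRing)
  open import Level using (0ℓ)

  -- The zero test lets the solver cancel vanishing coefficients; with a trivial test it
  -- fails on identities such as p * (1ℚ - q) + p * q ≡ p.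
  ℚ-ring : AlmostCommutativeRing 0ℓ 0ℓ
  ℚ-ring = fromCommutativeRing +-*-commutativeRing (λ p → dec⇒maybe (0ℚ ≟ p))

  toℚᵘ-/ : ∀ n d → toℚᵘ (+ n / suc d) ℚᵘ.≃ mkℚᵘ (+ n) d
  toℚᵘ-/ n d = toℚᵘ-fromℚᵘ (mkℚᵘ (+ n) d)

  /-≤-/ : ∀ a b c e .{{_ : ℕ.NonZero b}} .{{_ : ℕ.NonZero e}} →
          a ℕ.* e ℕ.≤ c ℕ.* b → + a / b ≤ + c / e
  /-≤-/ a (suc b) c (suc e) ae≤cb = toℚᵘ-cancel-≤
    (ℚᵘ.≤-respˡ-≃ (ℚᵘ.≃-sym (toℚᵘ-/ a b)) (ℚᵘ.≤-respʳ-≃ (ℚᵘ.≃-sym (toℚᵘ-/ c e))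
      (ℚᵘ.*≤* (subst₂ ℤ._≤_ (ℤ.pos-* a (suc e)) (ℤ.pos-* c (suc b)) (ℤ.+≤+ ae≤cb)))))

  /-<-/ : ∀ a b c e .{{_ : ℕ.NonZero b}} .{{_ : ℕ.NonZero e}} →
          a ℕ.* e ℕ.< c ℕ.* b → + a / b < + c / e
  /-<-/ a (suc b) c (suc e) ae<cb = toℚᵘ-cancel-<
    (ℚᵘ.<-respˡ-≃ (ℚᵘ.≃-sym (toℚᵘ-/ a b)) (ℚᵘ.<-respʳ-≃ (ℚᵘ.≃-sym (toℚᵘ-/ c e))
      (ℚᵘ.*<* (subst₂ ℤ._<_ (ℤ.pos-* a (suc e)) (ℤ.pos-* c (suc b)) (ℤ.+<+ ae<cb)))))

  /-*-/ : ∀ a b c e .{{_ : ℕ.NonZero b}} .{{_ : ℕ.NonZero e}} →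
          + a / b * (+ c / e) ≡ (+ (a ℕ.* c) / (b ℕ.* e)) {{ℕ.m*n≢0 b e}}
  /-*-/ a (suc b) c (suc e) = toℚᵘ-injective (begin-equality
    toℚᵘ (+ a / suc b * (+ c / suc e))          ≃⟨ toℚᵘ-homo-* (+ a / suc b) (+ c / suc e) ⟩
    toℚᵘ (+ a / suc b) ℚᵘ.* toℚᵘ (+ c / suc e)  ≃⟨ ℚᵘ.*-cong (toℚᵘ-/ a b) (toℚᵘ-/ c e) ⟩
    mkℚᵘ (+ a) b ℚᵘ.* mkℚᵘ (+ c) e              ≡⟨ cong (λ i → mkℚᵘ i _) (ℤ.pos-* a c) ⟨
    mkℚᵘ (+ (a ℕ.* c)) _                        ≃⟨ toℚᵘ-/ (a ℕ.* c) _ ⟨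
    toℚᵘ (+ (a ℕ.* c) / (suc b ℕ.* suc e))      ∎)
    where open ℚᵘ.≤-Reasoning

  open ≤-Reasoning

  p<q⇒0<q-p : ∀ {p q} → p < q → 0ℚ < q - p
  p<q⇒0<q-p {p} {q} p<q = begin-strict
    0ℚ     ≡⟨ +-inverseʳ p ⟨
    p - p  <⟨ +-monoˡ-< (- p) p<q ⟩
    q - p  ∎

  p≤p+q : ∀ p {q} → 0ℚ ≤ q → p ≤ p + q
  p≤p+q p {q} 0≤q = begin
    p       ≡⟨ +-identityʳ p ⟨
    p + 0ℚ  ≤⟨ +-monoʳ-≤ p 0≤q ⟩
    p + q   ∎

  0<p*q : ∀ {p q} → 0ℚ < p → 0ℚ < q → 0ℚ < p * q
  0<p*q {p} {q} 0<p 0<q = positive⁻¹ (p * q) {{pos*pos⇒pos p {{positive 0<p}} q {{positive 0<q}}}}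

  ∣p-q∣<r : ∀ {p q r} → p - q < r → q - p < r → ∣ p - q ∣ < r
  ∣p-q∣<r {p} {q} {r} p-q<r q-p<r with ∣p∣≡p∨∣p∣≡-p (p - q)
  ... | inj₁ ∣p-q∣≡p-q = subst (_< r) (sym ∣p-q∣≡p-q) p-q<r
  ... | inj₂ ∣p-q∣≡q-p = subst (_< r) (sym (trans ∣p-q∣≡q-p (neg-sub p q))) q-p<r
    where
    neg-sub : ∀ p q → - (p - q) ≡ q - p
    neg-sub = solve-∀ ℚ-ring

  step-antitone⇒antitone : ∀ (s : ℕ → ℚ) → (∀ n → s (suc n) ≤ s n) → ∀ {m n} → m ℕ.≤ n → s n ≤ s m
  step-antitone⇒antitone s step m≤n = go (ℕ.≤⇒≤′ m≤n)
    where
    go : ∀ {m n} → m ≤′ n → s n ≤ s m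
    go ≤′-refl = ≤-refl
    go (≤′-step m≤′n) = ≤-trans (step _) (go m≤′n)

  geometric-tail : ∀ (s x : ℕ → ℚ) k → (∀ n → 0ℚ ≤ x n) →
                   (∀ n → s n ≤ s (suc n) + x (suc n)) →
                   (∀ {n} → k ℕ.≤ n → x (suc (suc n)) ≤ + 1 / 4 * x (suc n)) →
                   ∀ {n} → k ℕ.≤ n → s k - s n ≤ + 4 / 3 * x (suc k)
  geometric-tail s x k x≥0 step decay {n} k≤n = begin
    s k - s n                        ≤⟨ p≤p+q (s k - s n) (*-monoˡ-≤-nonNeg (+ 4 / 3) (x≥0 (suc n))) ⟩
    s k - s n + + 4 / 3 * x (suc n)  ≤⟨ invariant (ℕ.≤⇒≤′ k≤n) ⟩
    + 4 / 3 * x (suc k)              ∎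
    where
    p-p+q≡q : ∀ p q → p - p + q ≡ q
    p-p+q≡q = solve-∀ ℚ-ring

    regroup : ∀ a b y → a - b + + 4 / 3 * (+ 1 / 4 * y) ≡ a - (b + y) + + 4 / 3 * y
    regroup = solve-∀ ℚ-ring

    invariant : ∀ {n} → k ≤′ n → s k - s n + + 4 / 3 * x (suc n) ≤ + 4 / 3 * x (suc k)
    invariant ≤′-refl = ≤-reflexive (p-p+q≡q (s k) (+ 4 / 3 * x (suc k)))
    invariant (≤′-step {n} k≤′n) = begin
      s k - s (suc n) + + 4 / 3 * x (suc (suc n))
        ≤⟨ +-monoʳ-≤ (s k - s (suc n)) (*-monoˡ-≤-nonNeg (+ 4 / 3) (decay (ℕ.≤′⇒≤ k≤′n))) ⟩
      s k - s (suc n) + + 4 / 3 * (+ 1 / 4 * x (suc n))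
        ≡⟨ regroup (s k) (s (suc n)) (x (suc n)) ⟩
      s k - (s (suc n) + x (suc n)) + + 4 / 3 * x (suc n)
        ≤⟨ +-monoˡ-≤ (+ 4 / 3 * x (suc n)) (+-monoʳ-≤ (s k) (neg-antimono-≤ (step n))) ⟩
      s k - s n + + 4 / 3 * x (suc n)
        ≤⟨ invariant k≤′n ⟩
      + 4 / 3 * x (suc k)  ∎

  antitone-tail⇒∣-∣< : ∀ (s : ℕ → ℚ) N {ε} → (∀ {n} → N ℕ.≤ n → s n ≤ s N) →
                         (∀ {n} → N ℕ.≤ n → s N - s n < ε) →
                         ∀ m n → N ℕ.≤ m → N ℕ.≤ n → ∣ s m - s n ∣ < ε
  antitone-tail⇒∣-∣< s N {ε} below tail m n N≤m N≤n =
    ∣p-q∣<r {s m} {s n} (one-sided N≤m N≤n) (one-sided N≤n N≤m)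
    where
    one-sided : ∀ {m n} → N ℕ.≤ m → N ℕ.≤ n → s m - s n < ε
    one-sided {n = n} N≤m N≤n = ≤-<-trans (+-monoˡ-≤ (- s n) (below N≤m)) (tail N≤n)

  inv-d-pos : ∀ j → 0ℚ < inv-d j
  inv-d-pos j = /-<-/ 0 1 1 (d j) (s≤s z≤n)
    where instance _ = d-nonZero j

  inv-d<1 : ∀ k → inv-d (suc (suc k)) < 1ℚ
  inv-d<1 k = /-<-/ 1 (d (suc (suc k))) 1 1 (ℕ.*-monoʳ-< 1 (1<d[2+k] k))
    where instance _ = d-nonZero (suc (suc k))

  inv-d-decay : ∀ {n} → 2 ℕ.≤ n → inv-d (suc (suc n)) ≤ + 1 / 4 * inv-d (suc n)
  inv-d-decay {n@(suc (suc k))} (s≤s (s≤s _)) = begin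
    + 1 / d (suc (suc n))
      ≤⟨ /-≤-/ 1 (d (suc (suc n))) 1 (4 ℕ.* d (suc n)) (ℕ.*-monoʳ-≤ 1 (4*d[3+k]≤d[4+k] k)) ⟩
    + 1 / (4 ℕ.* d (suc n))  ≡⟨ /-*-/ 1 4 1 (d (suc n)) ⟨
    + 1 / 4 * inv-d (suc n)  ∎
    where instance
            _ = d-nonZero (suc n)
            _ = d-nonZero (suc (suc n))
            _ = ℕ.m*n≢0 4 (d (suc n))

  -- For ε = (n+1)/(q+1) take N = q + 2: then 4/(3 d_{N+1}) ≤ 4/(9(q+3)) < 1/(q+1) ≤ ε.
  inv-d-small : ∀ ε → 0ℚ < ε → ∃[ N ] 2 ℕ.≤ N × + 4 / 3 * inv-d (suc N) < ε
  inv-d-small ε@(mkℚ ℤ.+[1+ n ] q _) _ = suc (suc q) , s≤s (s≤s z≤n) , (begin-strict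
    + 4 / 3 * inv-d (suc j)  ≡⟨ /-*-/ 4 3 1 (d (suc j)) ⟩
    + 4 / (3 ℕ.* d (suc j))  <⟨ /-<-/ 4 (3 ℕ.* d (suc j)) (suc n) (suc q)
                                  (ℕ.<-≤-trans (4*[1+k]<3*d[3+k] q) (ℕ.m≤n*m (3 ℕ.* d (suc j)) (suc n))) ⟩
    + suc n / suc q          ≡⟨ ↥p/↧p≡p ε ⟩
    ε                        ∎)
    where
    j = suc (suc q)
    instance
      _ = d-nonZero (suc j)
      _ = ℕ.m*n≢0 3 (d (suc j))
  inv-d-small (mkℚ ℤ.+0 _ _) (*<* (ℤ.+<+ ()))
  inv-d-small (mkℚ ℤ.-[1+ _ ] _ _) (*<* ())

  α-gap : ∀ n → α (suc (suc n)) + α (suc n) * inv-d (suc (suc n)) ≡ α (suc n)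
  α-gap n = p*[1-q]+p*q≡p (α (suc n)) (inv-d (suc (suc n)))
    where
    p*[1-q]+p*q≡p : ∀ p q → p * (1ℚ - q) + p * q ≡ p
    p*[1-q]+p*q≡p = solve-∀ ℚ-ring

  α-pos : ∀ n → 0ℚ < α n
  α-pos zero = positive⁻¹ 1ℚ
  α-pos (suc zero) = positive⁻¹ 1ℚ
  α-pos (suc (suc n)) = 0<p*q (α-pos (suc n)) (p<q⇒0<q-p (inv-d<1 n))

  α-suc≤α : ∀ n → α (suc n) ≤ α n
  α-suc≤α zero = ≤-refl
  α-suc≤α (suc n) = begin
    α (suc (suc n))
      ≤⟨ p≤p+q _ (<⇒≤ (0<p*q (α-pos (suc n)) (inv-d-pos (suc (suc n))))) ⟩
    α (suc (suc n)) + α (suc n) * inv-d (suc (suc n))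
      ≡⟨ α-gap n ⟩
    α (suc n)  ∎

  α-antitone : ∀ {m n} → m ℕ.≤ n → α n ≤ α m
  α-antitone = step-antitone⇒antitone α α-suc≤α

  α≤α-suc+inv-d : ∀ n → α n ≤ α (suc n) + inv-d (suc n)
  α≤α-suc+inv-d zero = p≤p+q 1ℚ (<⇒≤ (inv-d-pos 1))
  α≤α-suc+inv-d (suc n) = begin
    α (suc n)                                          ≡⟨ α-gap n ⟨
    α (suc (suc n)) + α (suc n) * inv-d (suc (suc n))  ≤⟨ +-monoʳ-≤ (α (suc (suc n))) α[1+n]*a≤a ⟩
    α (suc (suc n)) + inv-d (suc (suc n))              ∎
    where
    a = inv-d (suc (suc n))
    α[1+n]*a≤a : α (suc n) * a ≤ a
    α[1+n]*a≤a = begin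
      α (suc n) * a  ≤⟨ *-monoʳ-≤-nonNeg a (α-antitone {0} {suc n} z≤n) ⟩
      1ℚ * a         ≡⟨ *-identityˡ a ⟩
      a              ∎
      where instance _ = nonNegative (<⇒≤ (inv-d-pos (suc (suc n))))

  α-tail : ∀ {k n} → 2 ℕ.≤ k → k ℕ.≤ n → α k - α n ≤ + 4 / 3 * inv-d (suc k)
  α-tail {k} 2≤k = geometric-tail α inv-d k (λ j → <⇒≤ (inv-d-pos j)) α≤α-suc+inv-d
                     (λ k≤n → inv-d-decay (ℕ.≤-trans 2≤k k≤n))

  α-converges : Converges α
  α-converges ε 0<ε =
    let (N , 2≤N , small) = inv-d-small ε 0<ε in
    N , antitone-tail⇒∣-∣< α N α-antitone (λ N≤n → ≤-<-trans (α-tail 2≤N N≤n) small)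

  lim-α<α : ∀ {k} → 2 ℕ.≤ k → LimBelow α (α k)
  lim-α<α {k@(suc k′)} (s≤s _) = α k * inv-d (suc k) , 0<p*q (α-pos k) (inv-d-pos (suc k)) , suc k , bound
    where
    bound : ∀ m → suc k ℕ.≤ m → α m + α k * inv-d (suc k) ≤ α k
    bound m k<m = begin
      α m + α k * inv-d (suc k)        ≤⟨ +-monoˡ-≤ (α k * inv-d (suc k)) (α-antitone k<m) ⟩
      α (suc k) + α k * inv-d (suc k)  ≡⟨ α-gap k′ ⟩
      α k                              ∎

  α-2/d<lim-α : ∀ {k} → 2 ℕ.≤ k → LimAbove (α k - + 2 / 1 * inv-d (suc k)) α
  α-2/d<lim-α {k} 2≤k = + 2 / 3 * a , 0<p*q (positive⁻¹ (+ 2 / 3)) (inv-d-pos (suc k)) , k , bound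
    where
    a = inv-d (suc k)
    regroup : ∀ p q r → p - + 2 / 1 * r + + 2 / 3 * r ≡ q + (p - q) - + 4 / 3 * r
    regroup = solve-∀ ℚ-ring
    p+q-q≡p : ∀ p q → p + q - q ≡ p
    p+q-q≡p = solve-∀ ℚ-ring
    bound : ∀ m → k ℕ.≤ m → α k - + 2 / 1 * a + + 2 / 3 * a ≤ α m
    bound m k≤m = begin
      α k - + 2 / 1 * a + + 2 / 3 * a    ≡⟨ regroup (α k) (α m) a ⟩
      α m + (α k - α m) - + 4 / 3 * a    ≤⟨ +-monoˡ-≤ (- (+ 4 / 3 * a)) (+-monoʳ-≤ (α m) (α-tail 2≤k k≤m)) ⟩
      α m + + 4 / 3 * a - + 4 / 3 * a    ≡⟨ p+q-q≡p (α m) (+ 4 / 3 * a) ⟩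
      α m                                ∎

open import Data.Nat using (suc; _≤_)
open import Data.Rational using (_-_; _*_; _/_)
open import Data.Integer using (+_)
open import Data.Product using (_×_; _,_)

lemma2 : Converges α
    × (∀ k → 2 ≤ k → LimBelow α (α k) × LimAbove (α k - (+ 2) / 1 * inv-d (suc k)) α)
lemma2 = α-converges , λ k 2≤k → lim-α<α 2≤k , α-2/d<lim-α 2≤k
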